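{- There are absolute constants $0<c_1\le c_2$ such that for any $n,m\in\mathbb{N}$ with $n\geq 8m^2$ there is a convex set $A\subset\mathbb{R}$ with $c_1 n\le |A|\le c_2 n$ which contains at least $\frac{n}{4m}$ pairwise disjoint arithmetic progressions, each of length $m$.
   Context: A convex set is a finite set $A=\{a_1<\cdots<a_n\}\subset\mathbb{R}$ whose consecutive differences $a_{i+1}-a_i$ form a strictly increasing sequence. -}

module Defs where

open import Data.Nat using (ℕ; suc; _<_)
open import Data.Integer as ℤ using (ℤ; _-_)
open import Data.Product using (_×_)
open import Data.Rational.Unnormalised using (ℚᵘ; _/_)

-- A finite set A = {a 0 < a 1 < ... < a (k-1)} ⊂ ℤ, given by its increasing
-- enumeration a restricted to indices below k (values at indices ≥ k are
-- irrelevant).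
StrictlyIncreasing : ℕ → (ℕ → ℤ) → Set
StrictlyIncreasing k a = ∀ i → suc i < k → a i ℤ.< a (suc i)

IncreasingDifferences : ℕ → (ℕ → ℤ) → Set
IncreasingDifferences k a =
  ∀ i → suc (suc i) < k → (a (suc i) - a i) ℤ.< (a (suc (suc i)) - a (suc i))

Convex : ℕ → (ℕ → ℤ) → Set
Convex k a = StrictlyIncreasing k a × IncreasingDifferences k a

ℕ→ℚ : ℕ → ℚᵘ
ℕ→ℚ n = ℤ.+ n / 1

module Submission where

-- A is given by its strictly increasing sequence of gaps (consecutive differences), arranged
-- in m periods.  The gaps of period j lie in [u_j B, u_{j+1} B) with u_j = m + j, its first t
-- gaps are u_j B + r (r < t), and every period has the same total S.  Hence the point reached
-- after r gaps of period j is j S + r u_j B + r(r-1)/2 = x_r + j d_r with x_r = r m B + r(r-1)/2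
-- and d_r = S + r B: for each r < t these points, j < m, form an arithmetic progression.
-- To make period j sum to exactly S = D B + C it has q_j = ⌊D / u_j⌋ gaps: the remainder
-- e_j = D mod u_j is absorbed by e_j gaps raised by H, and one gap u_j B + α_j adjusts the
-- total.  So t m < |A| ≤ 1 + Σ_j D / u_j ≤ 1 + D = O(t m + m²), and t = ⌊n / m⌋ makes both
-- bounds linear in n.

open import Data.Nat using (ℕ)

module GapSequences where

  open import Data.Nat
  open import Data.Nat.Properties
  open import Data.Nat.ListAction using (sum)
  open import Data.Nat.Tactic.RingSolver using (solve-∀; solve)
  open import Data.Integer as ℤ using (ℤ)
  open import Data.Integer.Properties as ℤ using ([+m]-[+n]≡m⊖n; ≤-⊖)
  open import Data.List using (List; []; _∷_; _++_; take; length)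
  open import Data.Product using (_,_)
  open import Data.Empty using (⊥-elim)
  open import Relation.Binary.Definitions using (tri<; tri≈; tri>)
  open import Relation.Binary.PropositionalEquality

  open import Defs

  pos[m+n]-pos[m]≡pos[n] : ∀ m n → ℤ.+ (m + n) ℤ.- ℤ.+ m ≡ ℤ.+ n
  pos[m+n]-pos[m]≡pos[n] m n =
    trans ([+m]-[+n]≡m⊖n (m + n) m) (trans (≤-⊖ (m≤m+n m n)) (cong ℤ.+_ (m+n∸m≡n m n)))

  Convex-fromGaps : ∀ {k} (s g : ℕ → ℕ) →
    (∀ i → suc i < k → s (suc i) ≡ s i + g i) →
    (∀ i → suc i < k → 0 < g i) →
    (∀ i → suc (suc i) < k → g i < g (suc i)) →
    Convex k (λ i → ℤ.+ s i)
  Convex-fromGaps s g step positive increasing = strict , differences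
    where
    difference : ∀ i → suc i < _ → ℤ.+ s (suc i) ℤ.- ℤ.+ s i ≡ ℤ.+ g i
    difference i h = trans (cong (λ x → ℤ.+ x ℤ.- ℤ.+ s i) (step i h)) (pos[m+n]-pos[m]≡pos[n] (s i) (g i))

    strict : StrictlyIncreasing _ (λ i → ℤ.+ s i)
    strict i h = ℤ.+<+ (subst (s i <_) (sym (step i h)) (m<m+n (s i) (positive i h)))

    differences : IncreasingDifferences _ (λ i → ℤ.+ s i)
    differences i h = subst₂ ℤ._<_ (sym (difference i (<-trans (n<1+n (suc i)) h)))
                                   (sym (difference (suc i) h)) (ℤ.+<+ (increasing i h))

  triangle : ℕ → ℕ
  triangle zero    = 0
  triangle (suc a) = a + triangle a

  triangle≤square : ∀ a → triangle a ≤ a * a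
  triangle≤square zero    = z≤n
  triangle≤square (suc a) = begin
    a + triangle a      ≤⟨ +-monoʳ-≤ a (triangle≤square a) ⟩
    a + a * a           ≤⟨ m≤n+m (a + a * a) (suc a) ⟩
    suc a + (a + a * a) ≡⟨ solve (a ∷ []) ⟩
    suc a * suc a       ∎
    where open ≤-Reasoning

  consecutive : ℕ → ℕ → List ℕ
  consecutive c zero    = []
  consecutive c (suc a) = c ∷ consecutive (suc c) a

  length-consecutive : ∀ c a → length (consecutive c a) ≡ a
  length-consecutive c zero    = refl
  length-consecutive c (suc a) = cong suc (length-consecutive (suc c) a)

  sum-consecutive : ∀ c a → sum (consecutive c a) ≡ a * c + triangle a
  sum-consecutive c zero    = refl
  sum-consecutive c (suc a) = begin
    c + sum (consecutive (suc c) a)  ≡⟨ cong (c +_) (sum-consecutive (suc c) a) ⟩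
    c + (a * suc c + triangle a)     ≡⟨ regroup c a (triangle a) ⟩
    c + a * c + (a + triangle a)     ∎
    where
    open ≡-Reasoning
    regroup : ∀ c a t → c + (a * suc c + t) ≡ c + a * c + (a + t)
    regroup = solve-∀

  take-consecutive : ∀ c {a r} → r ≤ a → take r (consecutive c a) ≡ consecutive c r
  take-consecutive c {a}     {zero}  _       = refl
  take-consecutive c {suc a} {suc r} (s≤s h) = cong (c ∷_) (take-consecutive (suc c) h)

  nth : List ℕ → ℕ → ℕ
  nth []       _       = 0
  nth (x ∷ xs) zero    = x
  nth (x ∷ xs) (suc i) = nth xs i

  partialSum : List ℕ → ℕ → ℕ
  partialSum xs i = sum (take i xs)

  partialSum-suc : ∀ xs {i} → i < length xs → partialSum xs (suc i) ≡ partialSum xs i + nth xs i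
  partialSum-suc (x ∷ xs) {zero}  _       = +-identityʳ x
  partialSum-suc (x ∷ xs) {suc i} (s≤s h) =
    trans (cong (x +_) (partialSum-suc xs h)) (sym (+-assoc x _ _))

  partialSum-++ˡ : ∀ xs ys {i} → i ≤ length xs → partialSum (xs ++ ys) i ≡ partialSum xs i
  partialSum-++ˡ xs       ys {zero}  _       = refl
  partialSum-++ˡ (x ∷ xs) ys {suc i} (s≤s h) = cong (x +_) (partialSum-++ˡ xs ys h)

  partialSum-++ʳ : ∀ xs ys r → partialSum (xs ++ ys) (length xs + r) ≡ sum xs + partialSum ys r
  partialSum-++ʳ []       ys r = refl
  partialSum-++ʳ (x ∷ xs) ys r = trans (cong (x +_) (partialSum-++ʳ xs ys r)) (sym (+-assoc x _ _))

  data Chain (lo : ℕ) : List ℕ → ℕ → Set where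
    []  : ∀ {hi} → lo ≤ hi → Chain lo [] hi
    _∷_ : ∀ {x xs hi} → lo ≤ x → Chain (suc x) xs hi → Chain lo (x ∷ xs) hi

  _++ᶜ_ : ∀ {lo mid hi xs ys} → Chain lo xs mid → Chain mid ys hi → Chain lo (xs ++ ys) hi
  [] lo≤mid ++ᶜ (y≥mid ∷ ys) = ≤-trans lo≤mid y≥mid ∷ ys
  [] lo≤mid ++ᶜ [] mid≤hi    = [] (≤-trans lo≤mid mid≤hi)
  (x≥lo ∷ xs) ++ᶜ ys         = x≥lo ∷ (xs ++ᶜ ys)

  consecutive-chain : ∀ {lo hi} c a → lo ≤ c → c + a ≤ hi → Chain lo (consecutive c a) hi
  consecutive-chain c zero    lo≤c top  = [] (≤-trans lo≤c (≤-trans (m≤m+n c 0) top))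
  consecutive-chain c (suc a) lo≤c top  =
    lo≤c ∷ consecutive-chain (suc c) a ≤-refl (≤-trans (≤-reflexive (sym (+-suc c a))) top)

  Chain-lower : ∀ {lo xs hi} → Chain lo xs hi → ∀ {i} → i < length xs → lo ≤ nth xs i
  Chain-lower (x≥lo ∷ xs) {zero}  _       = x≥lo
  Chain-lower (x≥lo ∷ xs) {suc i} (s≤s h) = ≤-trans x≥lo (<⇒≤ (Chain-lower xs h))

  Chain-increasing : ∀ {lo xs hi} → Chain lo xs hi → ∀ {i} → suc i < length xs → nth xs i < nth xs (suc i)
  Chain-increasing (_ ∷ xs) {zero}  (s≤s h) = Chain-lower xs h
  Chain-increasing (_ ∷ xs) {suc i} (s≤s h) = Chain-increasing xs h

  Chain-convex : ∀ {lo gs hi} → Chain (suc lo) gs hi → Convex (suc (length gs)) (λ i → ℤ.+ partialSum gs i)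
  Chain-convex {gs = gs} chain = Convex-fromGaps (partialSum gs) (nth gs)
    (λ i h → partialSum-suc gs (≤-pred h))
    (λ i h → ≤-trans (s≤s z≤n) (Chain-lower chain (≤-pred h)))
    (λ i h → Chain-increasing chain (≤-pred h))

  StrictlyIncreasing-< : ∀ {k a i j} → StrictlyIncreasing k a → i < j → j < k → a i ℤ.< a j
  StrictlyIncreasing-< {k} {a} {i} increasing i<j = go (≤⇒≤′ i<j)
    where
    go : ∀ {j} → suc i ≤′ j → j < k → a i ℤ.< a j
    go ≤′-refl                j<k = increasing i j<k
    go (≤′-step {j′} i<j′) j<k = ℤ.<-trans (go i<j′ (<-trans (n<1+n j′) j<k)) (increasing j′ j<k)

  StrictlyIncreasing-injective : ∀ {k a i j} → StrictlyIncreasing k a → i < k → j < k → a i ≡ a j → i ≡ j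
  StrictlyIncreasing-injective {i = i} {j} increasing i<k j<k ai≡aj with <-cmp i j
  ... | tri< i<j _ _ = ⊥-elim (ℤ.<-irrefl ai≡aj (StrictlyIncreasing-< increasing i<j j<k))
  ... | tri≈ _ i≡j _ = i≡j
  ... | tri> _ _ j<i = ⊥-elim (ℤ.<-irrefl (sym ai≡aj) (StrictlyIncreasing-< increasing j<i i<k))

module Construction (m₀ n : ℕ) where

  open import Data.Nat
  open import Data.Nat.Properties
  open import Data.Nat.DivMod using (_/_; _%_; m≡m%n+[m/n]*n; m%n<n; m/n*n≤m; m≥n⇒m/n>0)
  open import Data.Nat.ListAction using (sum)
  open import Data.Nat.ListAction.Properties using (sum-++)
  open import Data.Nat.Tactic.RingSolver using (solve-∀)
  open import Data.Integer as ℤ using (ℤ)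
  open import Data.Integer.Properties as ℤ using (pos-+; pos-*)
  open import Data.List using (List; []; _∷_; _++_; take; length)
  open import Data.List.Properties using (length-++; length-++-≤ˡ; ++-assoc; ++-identityʳ)
  open import Data.Fin using (Fin; toℕ)
  open import Data.Fin.Properties using (toℕ<n; toℕ-injective)
  open import Data.Product using (Σ; ∃; _×_; _,_; proj₁)
  open import Data.Empty using (⊥-elim)
  open import Relation.Binary.Definitions using (tri<; tri≈; tri>)
  open import Relation.Binary.PropositionalEquality

  open import Defs
  open GapSequences

  -- G bounds every u j and e j; D is large enough that each period has at least t + e j + 1
  -- gaps; C exceeds the triangular numbers, so that α j ≥ p j; and H > α j.
  m t G D C H B S : ℕ
  m = suc m₀
  t = n / m
  G = m + m
  D = (t + G) * G + G
  C = suc (D * D + D * D + D)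
  H = suc (C + G * G)
  B = H + G
  S = D * B + C

  u q e p α : ℕ → ℕ
  u j = m + j
  q j = D / u j
  e j = D % u j
  p j = q j ∸ suc (e j)
  α j = C + e j * G ∸ (triangle (p j) + triangle (e j))

  period : ℕ → List ℕ
  period j = consecutive (u j * B) (p j) ++ u j * B + α j ∷ consecutive (u j * B + H) (e j)

  gaps : ℕ → List ℕ
  gaps zero    = []
  gaps (suc j) = gaps j ++ period j

  D≡e+q*u : ∀ j → D ≡ e j + q j * u j
  D≡e+q*u j = m≡m%n+[m/n]*n D (u j)

  u<G : ∀ {j} → j < m → u j < G
  u<G j<m = +-monoʳ-< m j<m

  e<G : ∀ {j} → j < m → e j < G
  e<G j<m = <-trans (m%n<n D (u _)) (u<G j<m)

  e≤D : ∀ j → e j ≤ D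
  e≤D j = ≤-trans (m≤m+n (e j) _) (≤-reflexive (sym (D≡e+q*u j)))

  q*m≤D : ∀ j → q j * m ≤ D
  q*m≤D j = ≤-trans (*-monoʳ-≤ (q j) (m≤m+n m j)) (≤-trans (m≤n+m _ (e j)) (≤-reflexive (sym (D≡e+q*u j))))

  p≤D : ∀ j → p j ≤ D
  p≤D j = ≤-trans (m∸n≤m (q j) (suc (e j))) (≤-trans (m≤m*n (q j) m) (q*m≤D j))

  q-large : ∀ {j} → j < m → t + suc (e j) ≤ q j
  q-large {j} j<m = *-cancelʳ-≤ (t + suc (e j)) (q j) (u j) (begin
    (t + suc (e j)) * u j  ≤⟨ *-mono-≤ (+-monoʳ-≤ t (e<G j<m)) (<⇒≤ (u<G j<m)) ⟩
    (t + G) * G            ≤⟨ +-cancelˡ-≤ G _ _ (begin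
      G + (t + G) * G        ≡⟨ +-comm G _ ⟩
      D                      ≡⟨ D≡e+q*u j ⟩
      e j + q j * u j        ≤⟨ +-monoˡ-≤ _ (<⇒≤ (e<G j<m)) ⟩
      G + q j * u j          ∎) ⟩
    q j * u j              ∎)
    where open ≤-Reasoning

  p+suc-e≡q : ∀ {j} → j < m → p j + suc (e j) ≡ q j
  p+suc-e≡q j<m = m∸n+n≡m (≤-trans (m≤n+m _ t) (q-large j<m))

  t≤p : ∀ {j} → j < m → t ≤ p j
  t≤p j<m = m+n≤o⇒m≤o∸n t (q-large j<m)

  triangles+p<C : ∀ j → triangle (p j) + triangle (e j) + p j < C
  triangles+p<C j = s≤s (+-mono-≤ (+-mono-≤ (square (p≤D j)) (square (e≤D j))) (p≤D j))
    where
    square : ∀ {a} → a ≤ D → triangle a ≤ D * D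
    square {a} a≤D = ≤-trans (triangle≤square a) (*-mono-≤ a≤D a≤D)

  α+triangles≡C+e*G : ∀ j → α j + (triangle (p j) + triangle (e j)) ≡ C + e j * G
  α+triangles≡C+e*G j = m∸n+n≡m (≤-trans (m≤m+n _ (p j)) (≤-trans (<⇒≤ (triangles+p<C j)) (m≤m+n C _)))

  p≤α : ∀ j → p j ≤ α j
  p≤α j = +-cancelʳ-≤ (triangle (p j) + triangle (e j)) (p j) (α j) (begin
    p j + (triangle (p j) + triangle (e j))  ≡⟨ +-comm (p j) _ ⟩
    triangle (p j) + triangle (e j) + p j    ≤⟨ <⇒≤ (triangles+p<C j) ⟩
    C                                        ≤⟨ m≤m+n C _ ⟩
    C + e j * G                              ≡⟨ α+triangles≡C+e*G j ⟨
    α j + (triangle (p j) + triangle (e j))  ∎)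
    where open ≤-Reasoning

  α<H : ∀ {j} → j < m → α j < H
  α<H {j} j<m = s≤s (begin
    α j                                      ≤⟨ m≤m+n (α j) _ ⟩
    α j + (triangle (p j) + triangle (e j))  ≡⟨ α+triangles≡C+e*G j ⟩
    C + e j * G                              ≤⟨ +-monoʳ-≤ C (*-monoˡ-≤ G (<⇒≤ (e<G j<m))) ⟩
    C + G * G                                ∎)
    where open ≤-Reasoning

  length-period : ∀ {j} → j < m → length (period j) ≡ q j
  length-period {j} j<m = begin
    length (period j)                       ≡⟨ length-++ (consecutive (u j * B) (p j)) ⟩
    length (consecutive (u j * B) (p j)) + suc (length (consecutive (u j * B + H) (e j)))
      ≡⟨ cong₂ (λ a b → a + suc b) (length-consecutive _ (p j)) (length-consecutive _ (e j)) ⟩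
    p j + suc (e j)                         ≡⟨ p+suc-e≡q j<m ⟩
    q j                                     ∎
    where open ≡-Reasoning

  sum-period : ∀ {j} → j < m → sum (period j) ≡ S
  sum-period {j} j<m = begin
    sum (period j)
      ≡⟨ sum-++ (consecutive (u j * B) (p j)) _ ⟩
    sum (consecutive (u j * B) (p j)) + (u j * B + α j + sum (consecutive (u j * B + H) (e j)))
      ≡⟨ cong₂ (λ a b → a + (u j * B + α j + b)) (sum-consecutive _ (p j)) (sum-consecutive _ (e j)) ⟩
    p j * (u j * B) + triangle (p j) + (u j * B + α j + (e j * (u j * B + H) + triangle (e j)))
      ≡⟨ regroup (p j) (e j) (u j * B) H (α j) (triangle (p j)) (triangle (e j)) ⟩
    (p j + suc (e j)) * (u j * B) + e j * H + (α j + (triangle (p j) + triangle (e j)))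
      ≡⟨ cong₂ (λ a b → a * (u j * B) + e j * H + b) (p+suc-e≡q j<m) (α+triangles≡C+e*G j) ⟩
    q j * (u j * B) + e j * H + (C + e j * G)
      ≡⟨ collect (q j) (u j) (e j) H G C ⟩
    (e j + q j * u j) * B + C
      ≡⟨ cong (λ a → a * B + C) (D≡e+q*u j) ⟨
    S ∎
    where
    open ≡-Reasoning
    regroup : ∀ p e U H α Tp Te →
      p * U + Tp + (U + α + (e * (U + H) + Te)) ≡ (p + suc e) * U + e * H + (α + (Tp + Te))
    regroup = solve-∀
    collect : ∀ q u e H G C → q * (u * (H + G)) + e * H + (C + e * G) ≡ (e + q * u) * (H + G) + C
    collect = solve-∀

  period-chain : ∀ {j} → j < m → Chain (u j * B) (period j) (u (suc j) * B)
  period-chain {j} j<m =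
    consecutive-chain _ (p j) ≤-refl (+-monoʳ-≤ (u j * B) (p≤α j))
    ++ᶜ (≤-refl ∷ consecutive-chain _ (e j) (+-monoʳ-< (u j * B) (α<H j<m)) top<next)
    where
    top<next : u j * B + H + e j ≤ u (suc j) * B
    top<next = begin
      u j * B + H + e j  ≤⟨ +-monoʳ-≤ (u j * B + H) (<⇒≤ (e<G j<m)) ⟩
      u j * B + H + G    ≡⟨ +-assoc (u j * B) H G ⟩
      u j * B + B        ≡⟨ +-comm (u j * B) B ⟩
      suc (u j) * B      ≡⟨ cong (_* B) (+-suc m j) ⟨
      u (suc j) * B      ∎
      where open ≤-Reasoning

  partialSum-period : ∀ {j r} → r ≤ p j → partialSum (period j) r ≡ r * (u j * B) + triangle r
  partialSum-period {j} {r} r≤p = begin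
    partialSum (period j) r                   ≡⟨ partialSum-++ˡ (consecutive (u j * B) (p j)) _ r≤length ⟩
    sum (take r (consecutive (u j * B) (p j))) ≡⟨ cong sum (take-consecutive _ r≤p) ⟩
    sum (consecutive (u j * B) r)             ≡⟨ sum-consecutive _ r ⟩
    r * (u j * B) + triangle r                ∎
    where
    open ≡-Reasoning
    r≤length : r ≤ length (consecutive (u j * B) (p j))
    r≤length = ≤-trans r≤p (≤-reflexive (sym (length-consecutive _ (p j))))

  gaps-chain : ∀ {j} → j ≤ m → Chain (m * B) (gaps j) (u j * B)
  gaps-chain {zero}  _   = [] (≤-reflexive (cong (_* B) (sym (+-identityʳ m))))
  gaps-chain {suc j} j<m = gaps-chain (<⇒≤ j<m) ++ᶜ period-chain j<m

  gaps-prefix : ∀ {j j′} → j ≤′ j′ → ∃ λ rest → gaps j′ ≡ gaps j ++ rest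
  gaps-prefix {j} ≤′-refl  = [] , sym (++-identityʳ (gaps j))
  gaps-prefix {j} (≤′-step {j′} h) with gaps-prefix h
  ... | rest , eq = rest ++ period j′ , trans (cong (_++ period j′) eq) (++-assoc (gaps j) rest _)

  length-gaps-mono : ∀ {j j′} → j ≤ j′ → length (gaps j) ≤ length (gaps j′)
  length-gaps-mono {j} j≤j′ with gaps-prefix (≤⇒≤′ j≤j′)
  ... | rest , eq = ≤-trans (length-++-≤ˡ (gaps j)) (≤-reflexive (cong length (sym eq)))

  length-gaps-suc : ∀ {j} → j < m → length (gaps (suc j)) ≡ length (gaps j) + q j
  length-gaps-suc {j} j<m = trans (length-++ (gaps j)) (cong (length (gaps j) +_) (length-period j<m))

  sum-gaps : ∀ {j} → j ≤ m → sum (gaps j) ≡ j * S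
  sum-gaps {zero}  _   = refl
  sum-gaps {suc j} j<m = begin
    sum (gaps j ++ period j)          ≡⟨ sum-++ (gaps j) (period j) ⟩
    sum (gaps j) + sum (period j)     ≡⟨ cong₂ _+_ (sum-gaps (<⇒≤ j<m)) (sum-period j<m) ⟩
    j * S + S                         ≡⟨ +-comm (j * S) S ⟩
    suc j * S                         ∎
    where open ≡-Reasoning

  length-gaps-lower : ∀ {j} → j ≤ m → j * t ≤ length (gaps j)
  length-gaps-lower {zero}  _   = z≤n
  length-gaps-lower {suc j} j<m = begin
    t + j * t                 ≡⟨ +-comm t (j * t) ⟩
    j * t + t                 ≤⟨ +-mono-≤ (length-gaps-lower (<⇒≤ j<m)) (≤-trans (m≤m+n t _) (q-large j<m)) ⟩
    length (gaps j) + q j     ≡⟨ length-gaps-suc j<m ⟨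
    length (gaps (suc j))     ∎
    where open ≤-Reasoning

  length-gaps-upper : ∀ {j} → j ≤ m → length (gaps j) * m ≤ j * D
  length-gaps-upper {zero}  _   = z≤n
  length-gaps-upper {suc j} j<m = begin
    length (gaps (suc j)) * m       ≡⟨ cong (_* m) (length-gaps-suc j<m) ⟩
    (length (gaps j) + q j) * m     ≡⟨ *-distribʳ-+ m (length (gaps j)) (q j) ⟩
    length (gaps j) * m + q j * m   ≤⟨ +-mono-≤ (length-gaps-upper (<⇒≤ j<m)) (q*m≤D j) ⟩
    j * D + D                       ≡⟨ +-comm (j * D) D ⟩
    suc j * D                       ∎
    where open ≤-Reasoning

  position : ℕ → ℕ → ℕ
  position j r = length (gaps j) + r

  position<length-gaps : ∀ {j j′ r} → j < j′ → j′ ≤ m → r < t → position j r < length (gaps j′)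
  position<length-gaps {j} {j′} {r} j<j′ j′≤m r<t = begin-strict
    length (gaps j) + r      <⟨ +-monoʳ-< (length (gaps j)) (<-≤-trans r<t (≤-trans (m≤m+n t _) (q-large j<m))) ⟩
    length (gaps j) + q j    ≡⟨ length-gaps-suc j<m ⟨
    length (gaps (suc j))    ≤⟨ length-gaps-mono j<j′ ⟩
    length (gaps j′)         ∎
    where
    open ≤-Reasoning
    j<m : j < m
    j<m = <-≤-trans j<j′ j′≤m

  position-injective : ∀ {j j′ r r′} → j < m → j′ < m → r < t → r′ < t →
                       position j r ≡ position j′ r′ → r ≡ r′
  position-injective {j} {j′} {r} {r′} j<m j′<m r<t r′<t eq with <-cmp j j′
  ... | tri< j<j′ _ _ = ⊥-elim (<-irrefl eq (<-≤-trans (position<length-gaps j<j′ (<⇒≤ j′<m) r<t) (m≤m+n _ r′)))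
  ... | tri≈ _ refl _ = +-cancelˡ-≡ (length (gaps j)) r r′ eq
  ... | tri> _ _ j′<j = ⊥-elim (<-irrefl (sym eq) (<-≤-trans (position<length-gaps j′<j (<⇒≤ j<m) r′<t) (m≤m+n _ r)))

  start step : ℕ → ℕ
  start r = r * (m * B) + triangle r
  step r = S + r * B

  partialSum-position : ∀ {j r} → j < m → r < t → partialSum (gaps m) (position j r) ≡ start r + j * step r
  partialSum-position {j} {r} j<m r<t with gaps-prefix (≤⇒≤′ j<m)
  ... | rest , gaps-m≡ = begin
    partialSum (gaps m) (position j r)
      ≡⟨ cong (λ gs → partialSum gs (position j r)) gaps-m≡ ⟩
    partialSum (gaps (suc j) ++ rest) (position j r)
      ≡⟨ partialSum-++ˡ (gaps (suc j)) rest (<⇒≤ (position<length-gaps (n<1+n j) j<m r<t)) ⟩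
    partialSum (gaps j ++ period j) (length (gaps j) + r)
      ≡⟨ partialSum-++ʳ (gaps j) (period j) r ⟩
    sum (gaps j) + partialSum (period j) r
      ≡⟨ cong₂ _+_ (sum-gaps (<⇒≤ j<m)) (partialSum-period (≤-trans (<⇒≤ r<t) (t≤p j<m))) ⟩
    j * S + (r * ((m + j) * B) + triangle r)
      ≡⟨ separate j S r m B (triangle r) ⟩
    start r + j * step r ∎
    where
    open ≡-Reasoning
    separate : ∀ j S r m B T → j * S + (r * ((m + j) * B) + T) ≡ r * (m * B) + T + j * (S + r * B)
    separate = solve-∀

  size : ℕ
  size = suc (length (gaps m))

  A : ℕ → ℤ
  A i = ℤ.+ partialSum (gaps m) i

  A-convex : Convex size A
  A-convex = Chain-convex (gaps-chain ≤-refl)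

  position<size : ∀ {j r} → j < m → r < t → position j r < size
  position<size j<m r<t = m<n⇒m<1+n (position<length-gaps j<m ≤-refl r<t)

  A-position : ∀ {j r} → j < m → r < t → A (position j r) ≡ ℤ.+ start r ℤ.+ ℤ.+ j ℤ.* ℤ.+ step r
  A-position {j} {r} j<m r<t = begin
    ℤ.+ partialSum (gaps m) (position j r)  ≡⟨ cong ℤ.+_ (partialSum-position j<m r<t) ⟩
    ℤ.+ (start r + j * step r)              ≡⟨ pos-+ (start r) (j * step r) ⟩
    ℤ.+ start r ℤ.+ ℤ.+ (j * step r)        ≡⟨ cong (ℤ._+_ (ℤ.+ start r)) (pos-* j (step r)) ⟩
    ℤ.+ start r ℤ.+ ℤ.+ j ℤ.* ℤ.+ step r    ∎
    where open ≡-Reasoning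

  first difference : Fin t → ℤ
  first r = ℤ.+ start (toℕ r)
  difference r = ℤ.+ step (toℕ r)

  difference-positive : ∀ r → ℤ.+ 0 ℤ.< difference r
  difference-positive r = ℤ.+<+ (≤-trans (s≤s z≤n) (≤-trans (m≤n+m C (D * B)) (m≤m+n S _)))

  progression⊆A : ∀ (r : Fin t) j → j < m → Σ ℕ λ i → i < size × A i ≡ first r ℤ.+ ℤ.+ j ℤ.* difference r
  progression⊆A r j j<m = position j (toℕ r) , position<size j<m (toℕ<n r) , A-position j<m (toℕ<n r)

  progressions-disjoint : ∀ (r r′ : Fin t) j j′ → j < m → j′ < m → r ≢ r′ →
    first r ℤ.+ ℤ.+ j ℤ.* difference r ≢ first r′ ℤ.+ ℤ.+ j′ ℤ.* difference r′
  progressions-disjoint r r′ j j′ j<m j′<m r≢r′ eq =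
    r≢r′ (toℕ-injective (position-injective j<m j′<m r<t r′<t same-position))
    where
    r<t : toℕ r < t
    r<t = toℕ<n r
    r′<t : toℕ r′ < t
    r′<t = toℕ<n r′
    same-position : position j (toℕ r) ≡ position j′ (toℕ r′)
    same-position = StrictlyIncreasing-injective (proj₁ A-convex) (position<size j<m r<t) (position<size j′<m r′<t)
      (trans (A-position j<m r<t) (trans eq (sym (A-position j′<m r′<t))))

  n≤2*t*m : m ≤ n → n ≤ 2 * (t * m)
  n≤2*t*m m≤n = begin
    n              ≡⟨ m≡m%n+[m/n]*n n m ⟩
    n % m + t * m  ≤⟨ +-monoˡ-≤ (t * m) (<⇒≤ (m%n<n n m)) ⟩
    m + t * m      ≤⟨ +-monoˡ-≤ (t * m) (m≤n*m m t ⦃ >-nonZero (m≥n⇒m/n>0 m≤n) ⦄) ⟩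
    t * m + t * m  ≡⟨ cong (t * m +_) (+-identityʳ (t * m)) ⟨
    2 * (t * m)    ∎
    where open ≤-Reasoning

  enough-progressions : m ≤ n → n ≤ 4 * m * t
  enough-progressions m≤n = ≤-trans (n≤2*t*m m≤n) (≤-trans (m≤m+n _ _) (≤-reflexive (double m t)))
    where
    double : ∀ m t → 2 * (t * m) + 2 * (t * m) ≡ 4 * m * t
    double = solve-∀

  size-lower : m ≤ n → n ≤ 2 * size
  size-lower m≤n = ≤-trans (n≤2*t*m m≤n) (*-monoʳ-≤ 2 (begin
    t * m              ≡⟨ *-comm t m ⟩
    m * t              ≤⟨ length-gaps-lower ≤-refl ⟩
    length (gaps m)    <⟨ n<1+n _ ⟩
    size               ∎))
    where open ≤-Reasoning

  size-upper : m * m ≤ n → size ≤ 9 * n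
  size-upper m*m≤n = begin
    suc (length (gaps m))                    ≤⟨ s≤s length≤D ⟩
    suc D                                    ≡⟨ cong suc (expand t m) ⟩
    1 + 2 * (t * m) + 4 * (m * m) + 2 * m    ≤⟨ +-mono-≤ (+-mono-≤ (+-mono-≤ 1≤n (*-monoʳ-≤ 2 t*m≤n))
                                                                   (*-monoʳ-≤ 4 m*m≤n)) (*-monoʳ-≤ 2 m≤n) ⟩
    n + 2 * n + 4 * n + 2 * n                ≡⟨ collect n ⟩
    9 * n                                    ∎
    where
    open ≤-Reasoning
    m≤n : m ≤ n
    m≤n = ≤-trans (m≤m*n m m) m*m≤n
    1≤n : 1 ≤ n
    1≤n = ≤-trans (s≤s z≤n) m≤n
    t*m≤n : t * m ≤ n
    t*m≤n = m/n*n≤m n m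
    length≤D : length (gaps m) ≤ D
    length≤D = *-cancelʳ-≤ _ D m (≤-trans (length-gaps-upper ≤-refl) (≤-reflexive (*-comm m D)))
    expand : ∀ t m → (t + (m + m)) * (m + m) + (m + m) ≡ 2 * (t * m) + 4 * (m * m) + 2 * m
    expand = solve-∀
    collect : ∀ n → n + 2 * n + 4 * n + 2 * n ≡ 9 * n
    collect = solve-∀

open import Defs
open import Data.Nat using (ℕ; _*_; _≤_; _<_)
open import Data.Integer as ℤ using (ℤ; _+_)
open import Data.Fin using (Fin)
open import Data.Product using (Σ; _×_; ∃; ∃-syntax)
open import Data.Rational.Unnormalised as ℚ using (ℚᵘ; 0ℚᵘ)
open import Relation.Binary.PropositionalEquality using (_≡_; _≢_)

open import Data.Nat using (zero; suc; s≤s; z≤n)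
open import Data.Nat.Properties using (≤-trans; *-comm; m≤n*m; m≤m*n)
open import Data.Integer.Properties as ℤ using (pos-*)
open import Data.Rational.Unnormalised using (½; *≤*; *<*)
open import Data.Product using (_,_)
open import Relation.Binary.PropositionalEquality using (sym; trans; subst; subst₂)

½*ℕ→ℚ-≤ : ∀ {n k} → n ≤ 2 * k → ½ ℚ.* ℕ→ℚ n ℚ.≤ ℕ→ℚ k
½*ℕ→ℚ-≤ {n} {k} n≤2k = *≤* (subst₂ ℤ._≤_ (sym (trans (ℤ.*-identityʳ _) (ℤ.*-identityˡ _))) (pos-* k 2)
                                         (ℤ.+≤+ (subst (n ≤_) (*-comm 2 k) n≤2k)))

ℕ→ℚ-≤-9* : ∀ {n k} → k ≤ 9 * n → ℕ→ℚ k ℚ.≤ ℕ→ℚ 9 ℚ.* ℕ→ℚ n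
ℕ→ℚ-≤-9* {n} k≤9n = *≤* (subst₂ ℤ._≤_ (sym (ℤ.*-identityʳ _)) (trans (pos-* 9 n) (sym (ℤ.*-identityʳ _)))
                                      (ℤ.+≤+ k≤9n))

theorem2p1 :
    Σ ℚᵘ λ c₁ → Σ ℚᵘ λ c₂ → (0ℚᵘ ℚ.< c₁ × c₁ ℚ.≤ c₂ ×
      (∀ (n m : ℕ) → 1 ≤ m → 8 * (m * m) ≤ n →
        Σ ℕ λ k → Σ (ℕ → ℤ) λ a → (Convex k a ×
          c₁ ℚ.* ℕ→ℚ n ℚ.≤ ℕ→ℚ k × ℕ→ℚ k ℚ.≤ c₂ ℚ.* ℕ→ℚ n ×
          -- t ≥ n/(4m) arithmetic progressions x r, x r + d r, ..., x r + (m-1) d r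
          Σ ℕ λ t → Σ (Fin t → ℤ) λ x → Σ (Fin t → ℤ) λ d → (n ≤ 4 * m * t ×
            (∀ (r : Fin t) → ℤ.+ 0 ℤ.< d r) ×
            (∀ (r : Fin t) (j : ℕ) → j < m →
              Σ ℕ λ i → (i < k × a i ≡ x r + ℤ.+ j ℤ.* d r)) ×
            (∀ (r r′ : Fin t) (j j′ : ℕ) → j < m → j′ < m → r ≢ r′ →
              x r + ℤ.+ j ℤ.* d r ≢ x r′ + ℤ.+ j′ ℤ.* d r′)))))
theorem2p1 = ½ , ℕ→ℚ 9 , *<* (ℤ.+<+ (s≤s z≤n)) , *≤* (ℤ.+≤+ (s≤s z≤n)) , λ where
  n zero () _
  n (suc m₀) _ 8m²≤n →
    let open Construction m₀ n
        m²≤n : m * m ≤ n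
        m²≤n = ≤-trans (m≤n*m (m * m) 8) 8m²≤n
        m≤n : m ≤ n
        m≤n = ≤-trans (m≤m*n m m) m²≤n
    in size , A , A-convex , ½*ℕ→ℚ-≤ (size-lower m≤n) , ℕ→ℚ-≤-9* {n} (size-upper m²≤n) ,
       t , first , difference , enough-progressions m≤n ,
       difference-positive , progression⊆A , progressions-disjoint
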